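{- Let $c\ge 0$ be an integer and let $f(x)=c$ (the linear function $mx+c$ with $m=0$). Then for every $n\ge 1$, $\pi(J^*_n(c))\in\{1,2,3,\ldots,c+1\}$.
   Context: For a function $f:\mathbb{N}\to\mathbb{N}_0$ and $n\in\mathbb{N}$, the finite linear Jaco graph $J_n(f(x))$ is the directed graph with vertex set $\{v_1,\dots,v_n\}$ whose arcs are determined recursively for $i=1,2,\dots,n$: for $i<j\le n$, $(v_i,v_j)$ is an arc if and only if $(f(i)+i)-d^-(v_i)\ge j$, where $d^-(v_i)$ is the in-degree of $v_i$ (the number of arcs $(v_h,v_i)$, $h<i$). $J^*_n(f(x))$ denotes the underlying undirected simple graph; for constant $f\equiv c$ it is written $J^*_n(c)$. A vertex colouring $\varphi$ of a graph $G$ is a Thue colouring if there is no $m\ge1$ and no path $v_1\cdots v_{2m}$ (distinct vertices, consecutive ones adjacent) with $\varphi(v_i)=\varphi(v_{i+m})$ for all $1\le i\le m$; $\pi(G)$ is the minimum number of colours of a Thue colouring (for a disconnected graph, the maximum over components). -}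

module Defs where

open import Data.Nat using (ℕ; zero; suc; _+_; _≤_; _<_; _≤?_; _≡ᵇ_)
open import Data.Bool using (if_then_else_)
open import Data.Fin using (Fin; toℕ; _↑ˡ_; _↑ʳ_)
open import Data.List using (List; length; filter; map; upTo)
open import Data.Product using (Σ; _×_)
open import Data.Sum using (_⊎_)
open import Relation.Nullary using (¬_)
open import Relation.Binary.PropositionalEquality using (_≡_)

-- Finite linear Jaco graphs  J_n(f(x))
-- Vertices are indexed 1,2,3,... (index 0 is unused).

-- degUpTo f k i  is the in-degree d⁻(v_i) for every 1 ≤ i ≤ k,
-- computed along the recursive definition i = 1, 2, ..., k.
-- d⁻(v_{k+1}) = #{ h ∈ [1,k] : (f h + h) - d⁻(v_h) ≥ k+1 }.
-- (The condition (f h + h) - d⁻(v_h) ≥ j is written j + d⁻(v_h) ≤ f h + h,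
--  which is equivalent since ℕ-subtraction is avoided.)
degUpTo : (ℕ → ℕ) → ℕ → ℕ → ℕ
degUpTo f zero = λ _ → 0
degUpTo f (suc k) i =
  if i ≡ᵇ suc k
  then length (filter (λ h → (suc k + degUpTo f k h) ≤? (f h + h)) (map suc (upTo k)))
  else degUpTo f k i

-- in-degree of v_i in J_n(f) (independent of n as long as i ≤ n)
inDeg : (ℕ → ℕ) → ℕ → ℕ
inDeg f i = degUpTo f i i

Arc : (ℕ → ℕ) → ℕ → ℕ → Set
Arc f i j = (i < j) × (j + inDeg f i ≤ f i + i)

-- Underlying undirected simple graph J*_n(f) on vertex set Fin n,
-- where x : Fin n stands for the vertex v_{toℕ x + 1}.
JacoAdj : (ℕ → ℕ) → (n : ℕ) → Fin n → Fin n → Set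
JacoAdj f n x y = Arc f (suc (toℕ x)) (suc (toℕ y)) ⊎ Arc f (suc (toℕ y)) (suc (toℕ x))

IsPath : {V : Set} → (V → V → Set) → {L : ℕ} → (Fin L → V) → Set
IsPath Adj {L} p =
  ((i j : Fin L) → p i ≡ p j → i ≡ j) ×
  ((i j : Fin L) → toℕ j ≡ suc (toℕ i) → Adj (p i) (p j))

Repetitive : {V C : Set} → (V → C) → (m : ℕ) → (Fin (m + m) → V) → Set
Repetitive φ m p = (i : Fin m) → φ (p (i ↑ˡ m)) ≡ φ (p (m ↑ʳ i))

IsThueColouring : {V : Set} → (V → V → Set) → {k : ℕ} → (V → Fin k) → Set
IsThueColouring {V} Adj φ =
  ¬ (Σ ℕ λ m → (1 ≤ m) × (Σ (Fin (m + m) → V) λ p → IsPath Adj p × Repetitive φ m p))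

IsThueNumber : {V : Set} → (V → V → Set) → ℕ → Set
IsThueNumber {V} Adj k =
  (Σ (V → Fin k) λ φ → IsThueColouring Adj φ) ×
  ((k' : ℕ) → (φ : V → Fin k') → IsThueColouring Adj φ → k ≤ k')

module Submission where

-- J*_n(c) is a disjoint union of cliques on c + 1 consecutive vertices,
-- so its Thue number is  min(n, c + 1).  Write d = c + 1 and index the
-- vertex v_{x+1} by x; its block is x / d.

open import Defs
open import Data.Nat using (ℕ; zero; suc; _+_; _*_; _∸_; _⊓_; _≤_; _<_; _≤?_; _≡ᵇ_; z≤n; s≤s; NonZero)
open import Data.Nat.Properties
open import Data.Nat.DivMod using (_/_; _%_; m≡m%n+[m/n]*n; m%n≡m∸m/n*n; m%n<n; m%n≤m; m*n/n≡m; m/n*n≤m; /-monoˡ-≤; m<n*o⇒m/o<n; m<n⇒m/n≡0)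
open import Data.Nat.Induction using (<-rec)
open import Data.Bool using (true; false; T)
open import Data.Fin as Fin using (Fin; toℕ; fromℕ<; _↑ˡ_; _↑ʳ_; inject≤)
open import Data.Fin.Properties using (toℕ-injective; toℕ<n; toℕ-fromℕ<; toℕ-↑ˡ; toℕ-↑ʳ; toℕ-inject≤; inject≤-injective; injective⇒≤)
open import Data.List using ([_]; length; filter; map; upTo; _++_)
open import Data.List.Properties using (upTo-∷ʳ; map-++; filter-++; length-++)
open import Data.Product using (Σ; _×_; _,_)
open import Data.Sum using (inj₁; inj₂)
open import Data.Empty using (⊥-elim)
open import Function using (_∘_)
open import Function.Bundles using (_⇔_; mk⇔; Equivalence)
import Function.Properties.Equivalence as ⇔
open import Relation.Nullary using (¬_; Dec; yes; no)
open import Relation.Binary using (tri<; tri≈; tri>)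
open import Relation.Binary.PropositionalEquality using (_≡_; _≢_; refl; sym; trans; cong; cong₂; subst; module ≡-Reasoning)
open ≡-Reasoning

open Equivalence using (to; from)

-- Among g 0, …, g (k - 1), a property which holds at g x exactly when a ≤ x
-- is satisfied k ∸ a times.  The in-degree of a vertex is such a count.
count-threshold : {P : ℕ → Set} (P? : (y : ℕ) → Dec (P y)) (g : ℕ → ℕ) (a k : ℕ) →
  (∀ x → x < k → P (g x) ⇔ a ≤ x) →
  length (filter P? (map g (upTo k))) ≡ k ∸ a
count-threshold P? g a zero _ = sym (0∸n≡0 a)
count-threshold P? g a (suc k) threshold = begin
    length (filter P? (map g (upTo (suc k))))
  ≡⟨ cong (length ∘ filter P? ∘ map g) (sym (upTo-∷ʳ k)) ⟩
    length (filter P? (map g (upTo k ++ [ k ])))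
  ≡⟨ cong (length ∘ filter P?) (map-++ g (upTo k) [ k ]) ⟩
    length (filter P? (map g (upTo k) ++ [ g k ]))
  ≡⟨ cong length (filter-++ P? (map g (upTo k)) [ g k ]) ⟩
    length (filter P? (map g (upTo k)) ++ filter P? [ g k ])
  ≡⟨ length-++ (filter P? (map g (upTo k))) ⟩
    length (filter P? (map g (upTo k))) + length (filter P? [ g k ])
  ≡⟨ cong (_+ length (filter P? [ g k ])) (count-threshold P? g a k (λ x → threshold x ∘ m<n⇒m<1+n)) ⟩
    (k ∸ a) + length (filter P? [ g k ])
  ≡⟨ last-index ⟩
    suc k ∸ a
  ∎
  where
    last-index : (k ∸ a) + length (filter P? [ g k ]) ≡ suc k ∸ a
    last-index with P? (g k)
    ... | yes pk = trans (+-comm (k ∸ a) 1) (sym (+-∸-assoc 1 (to (threshold k ≤-refl) pk)))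
    ... | no ¬pk = begin
        (k ∸ a) + 0   ≡⟨ +-identityʳ (k ∸ a) ⟩
        k ∸ a         ≡⟨ m≤n⇒m∸n≡0 (<⇒≤ k<a) ⟩
        0             ≡⟨ sym (m≤n⇒m∸n≡0 k<a) ⟩
        suc k ∸ a     ∎
      where
        k<a : k < a
        k<a = ≰⇒> (¬pk ∘ from (threshold k ≤-refl))

*-≤⇔≤-/ : ∀ d .{{_ : NonZero d}} q x → (q * d ≤ x) ⇔ (q ≤ x / d)
*-≤⇔≤-/ d q x = mk⇔
  (λ qd≤x → subst (_≤ x / d) (m*n/n≡m q d) (/-monoˡ-≤ d qd≤x))
  (λ q≤x/d → ≤-trans (*-monoˡ-≤ d q≤x/d) (m/n*n≤m x d))

div-mod-injective : ∀ d .{{_ : NonZero d}} {x y} → x % d ≡ y % d → x / d ≡ y / d → x ≡ y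
div-mod-injective d {x} {y} same-mod same-div = begin
  x                      ≡⟨ m≡m%n+[m/n]*n x d ⟩
  x % d + (x / d) * d    ≡⟨ cong₂ (λ r q → r + q * d) same-mod same-div ⟩
  y % d + (y / d) * d    ≡⟨ sym (m≡m%n+[m/n]*n y d) ⟩
  y                      ∎

-- With in-degree x % (c + 1), the vertex v_{x+1} of J(c) reaches v_{y+1}
-- exactly when y lies in the block of x or an earlier one: the reach
-- c + (x + 1) - x % (c + 1) is the end of the block of x.
reach-iff : ∀ c x y → (suc y + x % suc c ≤ c + suc x) ⇔ (y / suc c ≤ x / suc c)
reach-iff c x y = mk⇔ to′ from′
  where
    d = suc c
    r = x % d
    q = x / d
    block-end : c + suc x ≡ r + suc q * d
    block-end = begin
      c + suc x          ≡⟨ +-suc c x ⟩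
      d + x              ≡⟨ cong (d +_) (m≡m%n+[m/n]*n x d) ⟩
      d + (r + q * d)    ≡⟨ sym (+-assoc d r (q * d)) ⟩
      (d + r) + q * d    ≡⟨ cong (_+ q * d) (+-comm d r) ⟩
      (r + d) + q * d    ≡⟨ +-assoc r d (q * d) ⟩
      r + suc q * d      ∎
    to′ : suc y + r ≤ c + suc x → y / d ≤ q
    to′ h = ≤-pred (m<n*o⇒m/o<n (+-cancelˡ-≤ r (suc y) (suc q * d)
              (subst (_≤ r + suc q * d) (+-comm (suc y) r) (subst (suc y + r ≤_) block-end h))))
    from′ : y / d ≤ q → suc y + r ≤ c + suc x
    from′ y/d≤q = subst (suc y + r ≤_) (sym block-end)
                    (subst (_≤ r + suc q * d) (+-comm r (suc y)) (+-monoʳ-≤ r y<end))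
      where
        y<end : y < suc q * d
        y<end = ≰⇒> (λ end≤y → <⇒≱ (s≤s y/d≤q) (to (*-≤⇔≤-/ d (suc q) y) end≤y))

≡ᵇ-refl : ∀ k → (k ≡ᵇ k) ≡ true
≡ᵇ-refl zero = refl
≡ᵇ-refl (suc k) = ≡ᵇ-refl k

inDeg-suc : ∀ f k → inDeg f (suc k) ≡
  length (filter (λ h → (suc k + degUpTo f k h) ≤? (f h + h)) (map suc (upTo k)))
inDeg-suc f k rewrite ≡ᵇ-refl k = refl

degUpTo-stable : ∀ f k {i} → 1 ≤ i → i ≤ k → degUpTo f k i ≡ inDeg f i
degUpTo-stable f zero (s≤s _) ()
degUpTo-stable f (suc k) {i} 1≤i i≤k with i ≟ suc k
... | yes refl = refl
... | no i≢k with i ≡ᵇ suc k in eq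
...   | true = ⊥-elim (i≢k (≡ᵇ⇒≡ i (suc k) (subst T (sym eq) _)))
...   | false = degUpTo-stable f k 1≤i (≤-pred (≤∧≢⇒< i≤k i≢k))

inDeg-const : ∀ c x → inDeg (λ _ → c) (suc x) ≡ x % suc c
inDeg-const c = <-rec _ step
  where
    f : ℕ → ℕ
    f _ = c
    d = suc c
    step : ∀ k → (∀ {x} → x < k → inDeg f (suc x) ≡ x % d) → inDeg f (suc k) ≡ k % d
    step k ih = begin
        inDeg f (suc k)
      ≡⟨ inDeg-suc f k ⟩
        length (filter (λ h → (suc k + degUpTo f k h) ≤? (c + h)) (map suc (upTo k)))
      ≡⟨ count-threshold _ suc ((k / d) * d) k points-at-k ⟩
        k ∸ (k / d) * d
      ≡⟨ sym (m%n≡m∸m/n*n k d) ⟩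
        k % d
      ∎
      where
        points-at-k : ∀ x → x < k → (suc k + degUpTo f k (suc x) ≤ c + suc x) ⇔ ((k / d) * d ≤ x)
        points-at-k x x<k rewrite degUpTo-stable f k (s≤s z≤n) x<k | ih x<k =
          ⇔.trans (reach-iff c x k)
            (⇔.sym (*-≤⇔≤-/ d (k / d) x))

block : ∀ c {n} → Fin n → ℕ
block c v = toℕ v / suc c

arc⇒same-block : ∀ c x y → Arc (λ _ → c) (suc x) (suc y) → x / suc c ≡ y / suc c
arc⇒same-block c x y (x<y , in-reach) =
  ≤-antisym (/-monoˡ-≤ (suc c) (<⇒≤ (≤-pred x<y)))
            (to (reach-iff c x y) (subst (λ t → suc y + t ≤ c + suc x) (inDeg-const c x) in-reach))

same-block⇒arc : ∀ c x y → x < y → x / suc c ≡ y / suc c → Arc (λ _ → c) (suc x) (suc y)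
same-block⇒arc c x y x<y same =
  s≤s x<y , subst (λ t → suc y + t ≤ c + suc x) (sym (inDeg-const c x))
                  (from (reach-iff c x y) (≤-reflexive (sym same)))

adjacent⇒same-block : ∀ c n (u v : Fin n) → JacoAdj (λ _ → c) n u v → block c u ≡ block c v
adjacent⇒same-block c n u v (inj₁ arc) = arc⇒same-block c (toℕ u) (toℕ v) arc
adjacent⇒same-block c n u v (inj₂ arc) = sym (arc⇒same-block c (toℕ v) (toℕ u) arc)

same-block⇒adjacent : ∀ c n (u v : Fin n) → u ≢ v → block c u ≡ block c v → JacoAdj (λ _ → c) n u v
same-block⇒adjacent c n u v u≢v same with <-cmp (toℕ u) (toℕ v)
... | tri< u<v _ _ = inj₁ (same-block⇒arc c (toℕ u) (toℕ v) u<v same)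
... | tri≈ _ u≡v _ = ⊥-elim (u≢v (toℕ-injective u≡v))
... | tri> _ _ v<u = inj₂ (same-block⇒arc c (toℕ v) (toℕ u) v<u (sym same))

↑-halves-differ : ∀ {m} (i : Fin m) → i ↑ˡ m ≢ m ↑ʳ i
↑-halves-differ {suc m} i eq =
  m≢1+n+m (toℕ i) (trans (sym (toℕ-↑ˡ i (suc m))) (trans (cong toℕ eq) (toℕ-↑ʳ (suc m) i)))

ConsecutiveAdjacent : {V : Set} → (V → V → Set) → {L : ℕ} → (Fin L → V) → Set
ConsecutiveAdjacent Adj {L} p = (i j : Fin L) → toℕ j ≡ suc (toℕ i) → Adj (p i) (p j)

module _ {V A : Set} {Adj : V → V → Set} (B : V → A)
         (B-invariant : ∀ u v → Adj u v → B u ≡ B v) where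

  constant-from-start : ∀ {L} (p : Fin (suc L) → V) → ConsecutiveAdjacent Adj p →
    ∀ i → B (p i) ≡ B (p Fin.zero)
  constant-from-start p adjacent Fin.zero = refl
  constant-from-start {suc L} p adjacent (Fin.suc i) =
    trans (constant-from-start (p ∘ Fin.suc) (λ i j e → adjacent (Fin.suc i) (Fin.suc j) (cong suc e)) i)
          (sym (B-invariant _ _ (adjacent Fin.zero (Fin.suc Fin.zero) refl)))

  constant-along-path : ∀ {L} (p : Fin L → V) → ConsecutiveAdjacent Adj p →
    ∀ i j → B (p i) ≡ B (p j)
  constant-along-path {suc L} p adjacent i j =
    trans (constant-from-start p adjacent i) (sym (constant-from-start p adjacent j))

  -- A colouring separating the vertices of every class of B is Thue: the two
  -- halves of a repetitive path start at distinct vertices of one class with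
  -- one colour.
  classwise-injective⇒thue : ∀ {k} (φ : V → Fin k) →
    (∀ u v → φ u ≡ φ v → B u ≡ B v → u ≡ v) → IsThueColouring Adj φ
  classwise-injective⇒thue φ separates (suc m , _ , p , (distinct , adjacent) , repetitive) =
    ↑-halves-differ Fin.zero (distinct _ _
      (separates _ _ (repetitive Fin.zero) (constant-along-path p adjacent _ _)))

-- An edge whose ends have one colour is a repetitive path on two vertices.
monochromatic-edge⇒¬thue : {V : Set} {Adj : V → V → Set} {k : ℕ} (φ : V → Fin k) {u v : V} →
  u ≢ v → Adj u v → φ u ≡ φ v → ¬ IsThueColouring Adj φ
monochromatic-edge⇒¬thue {V} {Adj} φ {u} {v} u≢v uv same-colour thue =
  thue (1 , ≤-refl , edge , (distinct , adjacent) , λ { Fin.zero → same-colour })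
  where
    edge : Fin 2 → V
    edge Fin.zero = u
    edge (Fin.suc _) = v
    distinct : ∀ i j → edge i ≡ edge j → i ≡ j
    distinct Fin.zero Fin.zero _ = refl
    distinct Fin.zero (Fin.suc Fin.zero) eq = ⊥-elim (u≢v eq)
    distinct (Fin.suc Fin.zero) Fin.zero eq = ⊥-elim (u≢v (sym eq))
    distinct (Fin.suc Fin.zero) (Fin.suc Fin.zero) _ = refl
    adjacent : ConsecutiveAdjacent Adj edge
    adjacent Fin.zero (Fin.suc Fin.zero) _ = uv
    adjacent Fin.zero Fin.zero ()
    adjacent (Fin.suc Fin.zero) Fin.zero ()
    adjacent (Fin.suc Fin.zero) (Fin.suc Fin.zero) ()

clique⇒colours : {V : Set} {Adj : V → V → Set} {k : ℕ} (e : Fin k → V) →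
  (∀ a b → e a ≡ e b → a ≡ b) → (∀ a b → a ≢ b → Adj (e a) (e b)) →
  ∀ {k′} (φ : V → Fin k′) → IsThueColouring Adj φ → k ≤ k′
clique⇒colours {Adj = Adj} e e-injective clique φ thue = injective⇒≤ colours-distinct
  where
    colours-distinct : ∀ {a b} → φ (e a) ≡ φ (e b) → a ≡ b
    colours-distinct {a} {b} same-colour with a Fin.≟ b
    ... | yes a≡b = a≡b
    ... | no a≢b = ⊥-elim (monochromatic-edge⇒¬thue {Adj = Adj} φ (a≢b ∘ e-injective a b) (clique a b a≢b) same-colour thue)

residue-colouring : ∀ c n → Fin n → Fin (n ⊓ suc c)
residue-colouring c n v = fromℕ< (⊓-glb (≤-<-trans (m%n≤m (toℕ v) (suc c)) (toℕ<n v)) (m%n<n (toℕ v) (suc c)))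

-- Residue and block determine a vertex, so the residue colouring is Thue.
residue-colouring-thue : ∀ c n → IsThueColouring (JacoAdj (λ _ → c) n) (residue-colouring c n)
residue-colouring-thue c n =
  classwise-injective⇒thue (block c) (adjacent⇒same-block c n) (residue-colouring c n) separates
  where
    separates : ∀ u v → residue-colouring c n u ≡ residue-colouring c n v → block c u ≡ block c v → u ≡ v
    separates u v same-colour same-block = toℕ-injective (div-mod-injective (suc c)
      (trans (sym (toℕ-fromℕ< _)) (trans (cong toℕ same-colour) (toℕ-fromℕ< _))) same-block)

-- The first min(n, c + 1) vertices all lie in block 0, hence form a clique.
initial-vertices : ∀ c n → Fin (n ⊓ suc c) → Fin n
initial-vertices c n a = inject≤ a (m⊓n≤m n (suc c))

initial-vertices-clique : ∀ c n a b → a ≢ b →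
  JacoAdj (λ _ → c) n (initial-vertices c n a) (initial-vertices c n b)
initial-vertices-clique c n a b a≢b =
  same-block⇒adjacent c n _ _ (a≢b ∘ inject≤-injective _ _ a b) (trans (in-block-0 a) (sym (in-block-0 b)))
  where
    in-block-0 : ∀ a → block c (initial-vertices c n a) ≡ 0
    in-block-0 a = m<n⇒m/n≡0 (subst (_< suc c) (sym (toℕ-inject≤ a _)) (m<n⊓o⇒m<o n (suc c) (toℕ<n a)))

proposition3p2 : (c n : ℕ) → 1 ≤ n →
    Σ ℕ λ k → IsThueNumber (JacoAdj (λ _ → c) n) k × (1 ≤ k) × (k ≤ suc c)
proposition3p2 c n 1≤n =
  n ⊓ suc c , (upper-bound , lower-bound) , ⊓-glb 1≤n (s≤s z≤n) , m⊓n≤n n (suc c)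
  where
    G = JacoAdj (λ _ → c) n
    upper-bound : Σ (Fin n → Fin (n ⊓ suc c)) (IsThueColouring G)
    upper-bound = residue-colouring c n , residue-colouring-thue c n
    lower-bound : ∀ k′ (φ : Fin n → Fin k′) → IsThueColouring G φ → n ⊓ suc c ≤ k′
    lower-bound _ = clique⇒colours {Adj = G} (initial-vertices c n)
                      (inject≤-injective _ _) (initial-vertices-clique c n)
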